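{- For every graph $G$ with maximum degree $c$, $\mathrm{dmw}(G)\ge \mathrm{mw}(G)/(2c^2+2c+1)$.
   Context: The matching width $\mathrm{mw}(G)$ is the minimum, over all orderings $SV$ of $V(G)$, of the maximum, over all prefixes $V_1$ of $SV$, of the size of a largest matching consisting of edges between $V_1$ and $V(G)\setminus V_1$. A matching $M$ is distant if no two vertices incident to distinct edges of $M$ are adjacent or have a common neighbour; the distant matching width $\mathrm{dmw}(G)$ is defined as $\mathrm{mw}(G)$ with "matching" replaced by "distant matching". -}

module Defs where

open import Data.Nat using (ℕ; _≤_; _<_; _⊔_)
open import Data.Bool using (Bool; true; false)
open import Data.Fin using (Fin; toℕ)
open import Data.List using (List; []; _∷_; length; lookup; map; foldr; filterᵇ; allFin)
open import Data.List.Relation.Unary.Unique.Propositional using (Unique)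
open import Data.List.Relation.Unary.All using (All)
open import Data.Product using (Σ; ∃; _×_; _,_; proj₁; proj₂)
open import Data.Sum using (_⊎_)
open import Relation.Nullary using (¬_)
open import Relation.Binary.PropositionalEquality using (_≡_; _≢_)
open import Function.Definitions using (Injective)

record Graph : Set where
  field
    n     : ℕ
    adj   : Fin n → Fin n → Bool
    sym   : ∀ u v → adj u v ≡ adj v u
    irrefl : ∀ v → adj v v ≡ false
open Graph public

module _ (G : Graph) where
  V : Set
  V = Fin (n G)

  Adj : V → V → Set
  Adj u v = adj G u v ≡ true

  degree : V → ℕ
  degree v = length (filterᵇ (adj G v) (allFin (n G)))

  -- maximum degree (0 for the graph with no vertices)
  maxDegree : ℕ
  maxDegree = foldr _⊔_ 0 (map degree (allFin (n G)))

  endpoints : List (V × V) → List V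
  endpoints [] = []
  endpoints ((u , v) ∷ es) = u ∷ v ∷ endpoints es

  IsMatching : List (V × V) → Set
  IsMatching M = All (λ e → Adj (proj₁ e) (proj₂ e)) M × Unique (endpoints M)

  _isEndOf_ : V → V × V → Set
  x isEndOf (u , v) = (x ≡ u) ⊎ (x ≡ v)

  IsDistantMatching : List (V × V) → Set
  IsDistantMatching M = IsMatching M ×
    (∀ (i j : Fin (length M)) → i ≢ j → ∀ x y → x isEndOf lookup M i → y isEndOf lookup M j →
       ¬ Adj x y × ¬ (∃ λ z → Adj x z × Adj z y))

  -- an ordering of V(G): a bijection Fin n → V (injective endomap of a finite set)
  Ordering : Set
  Ordering = Σ (Fin (n G) → V) (Injective _≡_ _≡_)

  InPrefix : Ordering → ℕ → V → Set
  InPrefix σ k v = ∃ λ (i : Fin (n G)) → proj₁ σ i ≡ v × toℕ i < k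

  Crossing : Ordering → ℕ → List (V × V) → Set
  Crossing σ k M = All (λ e → InPrefix σ k (proj₁ e) × ¬ InPrefix σ k (proj₂ e)) M

  WidthAtMost : (List (V × V) → Set) → Ordering → ℕ → Set
  WidthAtMost P σ w = ∀ k → k ≤ n G → ∀ M → P M → Crossing σ k M → length M ≤ w

  -- m is the min over orderings of the max over prefixes of the largest P-matching
  IsWidth : (List (V × V) → Set) → ℕ → Set
  IsWidth P m = (∃ λ σ → WidthAtMost P σ m) × (∀ σ w → WidthAtMost P σ w → m ≤ w)

  IsMW : ℕ → Set
  IsMW = IsWidth IsMatching

  IsDMW : ℕ → Set
  IsDMW = IsWidth IsDistantMatching

-- Greedily build a distant submatching D of a matching M: take an edge e of M, discard
-- every remaining edge with an endpoint within distance 2 of an endpoint of e, and recurse.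
-- The vertices within distance 2 of e number at most 2c + 2c², and since the endpoints
-- of M are distinct, at most that many edges are discarded together with e. Hence
-- |M| ≤ (2c² + 2c + 1) |D|, and D crosses every prefix cut that M crosses.
module Submission where

open import Defs hiding (sym)
open import Data.Bool.Properties using (T-≡)
open import Data.Fin using (Fin; zero; suc) renaming (_≟_ to _≟ᶠ_)
open import Data.List using (List; []; _∷_; _++_; length; lookup; map; foldr; filter; filterᵇ; concatMap; allFin)
open import Data.List.Properties using (length-++; length-filter; length-removeAt′)
open import Data.List.Membership.Propositional using (_∈_)
open import Data.List.Membership.Propositional.Properties
  using (∈-++⁺ˡ; ∈-++⁺ʳ; ∈-allFin; ∈-map⁺; ∈-filter⁺; ∈-concatMap⁺; ∈-lookup)
open import Data.List.Relation.Binary.Sublist.Propositional using (_⊆_; []; _∷_; _∷ʳ_; ⊆-trans)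
open import Data.List.Relation.Binary.Sublist.Propositional.Properties using (All-resp-⊆; filter-⊆)
open import Data.List.Relation.Unary.All as All using (All; []; _∷_)
open import Data.List.Relation.Unary.All.Properties using (all-filter)
open import Data.List.Relation.Unary.AllPairs using (AllPairs; []; _∷_)
open import Data.List.Relation.Unary.Any as Any using (here; there; index; _─_)
open import Data.List.Relation.Unary.Unique.Propositional using (Unique)
open import Data.Nat using (ℕ; suc; _+_; _*_; _⊔_; _≤_; z≤n; s≤s)
open import Data.Nat.Properties
open import Data.Nat.Tactic.RingSolver using (solve-∀)
open import Data.Product using (∃; _×_; _,_; proj₁; proj₂)
open import Data.Sum using (_⊎_; inj₁; inj₂)
open import Function using (_∘_; Equivalence)
open import Relation.Binary.Definitions using (Symmetric)
open import Relation.Binary.PropositionalEquality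
  using (_≡_; _≢_; refl; sym; trans; cong; subst; ≢-sym)
open import Relation.Nullary using (¬_; yes; no; contradiction)
open import Relation.Nullary.Decidable using (_⊎-dec_)
open import Relation.Unary using (Decidable)
open import Relation.Unary.Properties using (∁?)

private
  variable
    A : Set
    x y : A
    xs ys : List A

AllPairs-resp-⊇ : {R : A → A → Set} → xs ⊆ ys → AllPairs R ys → AllPairs R xs
AllPairs-resp-⊇ []           []       = []
AllPairs-resp-⊇ (_ ∷ʳ sub)   (_ ∷ rs) = AllPairs-resp-⊇ sub rs
AllPairs-resp-⊇ (refl ∷ sub) (r ∷ rs) = All-resp-⊆ sub r ∷ AllPairs-resp-⊇ sub rs

AllPairs-lookup : {R : A → A → Set} → Symmetric R → AllPairs R xs →
                  {i j : Fin (length xs)} → i ≢ j → R (lookup xs i) (lookup xs j)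
AllPairs-lookup R-sym (r ∷ rs) {zero}  {zero}  i≢j = contradiction refl i≢j
AllPairs-lookup R-sym (r ∷ rs) {zero}  {suc j} _   = All.lookup r (∈-lookup j)
AllPairs-lookup R-sym (r ∷ rs) {suc i} {zero}  _   = R-sym (All.lookup r (∈-lookup i))
AllPairs-lookup R-sym (r ∷ rs) {suc i} {suc j} i≢j = AllPairs-lookup R-sym rs (i≢j ∘ cong suc)

∈-─⁺ : (x∈ys : x ∈ ys) → y ∈ ys → y ≢ x → y ∈ (ys ─ x∈ys)
∈-─⁺ (here refl)  (here refl)  y≢x = contradiction refl y≢x
∈-─⁺ (here refl)  (there y∈ys) _   = y∈ys
∈-─⁺ (there _)    (here refl)  _   = here refl
∈-─⁺ (there x∈ys) (there y∈ys) y≢x = there (∈-─⁺ x∈ys y∈ys y≢x)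

Unique-length-≤ : Unique xs → All (_∈ ys) xs → length xs ≤ length ys
Unique-length-≤ [] [] = z≤n
Unique-length-≤ {ys = ys} (x∉xs ∷ xs!) (x∈ys ∷ xs⊆ys) = begin
  suc _                        ≤⟨ s≤s (Unique-length-≤ xs! xs⊆ys─x) ⟩
  suc (length (ys ─ x∈ys))     ≡⟨ sym (length-removeAt′ ys (index x∈ys)) ⟩
  length ys                    ∎
  where
  open ≤-Reasoning
  xs⊆ys─x = All.zipWith (λ (y∈ys , x≢y) → ∈-─⁺ x∈ys y∈ys (≢-sym x≢y)) (xs⊆ys , x∉xs)

length-concatMap-≤ : {B : Set} (f : A → List B) {c : ℕ} → (∀ x → length (f x) ≤ c) →
                     ∀ xs → length (concatMap f xs) ≤ length xs * c
length-concatMap-≤ f f≤c []       = z≤n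
length-concatMap-≤ f f≤c (x ∷ xs) = begin
  length (f x ++ concatMap f xs)          ≡⟨ length-++ (f x) ⟩
  length (f x) + length (concatMap f xs)  ≤⟨ +-mono-≤ (f≤c x) (length-concatMap-≤ f f≤c xs) ⟩
  _ + length xs * _                       ∎
  where open ≤-Reasoning

length-filter+length-filter-∁ : {P : A → Set} (P? : Decidable P) → ∀ xs →
                                length (filter P? xs) + length (filter (∁? P?) xs) ≡ length xs
length-filter+length-filter-∁ P? [] = refl
length-filter+length-filter-∁ P? (x ∷ xs) with P? x
... | yes _ = cong suc (length-filter+length-filter-∁ P? xs)
... | no  _ = trans (+-suc _ _) (cong suc (length-filter+length-filter-∁ P? xs))

≤-foldr-⊔ : {n : ℕ} {ns : List ℕ} → n ∈ ns → n ≤ foldr _⊔_ 0 ns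
≤-foldr-⊔ (here refl) = m≤m⊔n _ _
≤-foldr-⊔ (there n∈ns) = m≤n⇒m≤o⊔n _ (≤-foldr-⊔ n∈ns)

suc-+-≤-*-suc : ∀ {a b} k d → a ≤ k → b ≤ (k + 1) * d → suc (a + b) ≤ (k + 1) * suc d
suc-+-≤-*-suc {a} {b} k d a≤k b≤ = begin
  suc (a + b)               ≤⟨ s≤s (+-mono-≤ a≤k b≤) ⟩
  suc (k + (k + 1) * d)     ≡⟨ sym (+-suc k _) ⟩
  k + (1 + (k + 1) * d)     ≡⟨ sym (+-assoc k 1 _) ⟩
  (k + 1) + (k + 1) * d     ≡⟨ sym (*-suc (k + 1) d) ⟩
  (k + 1) * suc d           ∎
  where open ≤-Reasoning

module _ (G : Graph) where

  Edge : Set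
  Edge = V G × V G

  degree≤maxDegree : ∀ v → degree G v ≤ maxDegree G
  degree≤maxDegree v = ≤-foldr-⊔ (∈-map⁺ (degree G) (∈-allFin v))

  _∈ᵉ_ : V G → Edge → Set
  u ∈ᵉ e = _isEndOf_ G u e

  Adj-sym : {u v : V G} → Adj G u v → Adj G v u
  Adj-sym {u} {v} uv = trans (Graph.sym G v u) uv

  neighbours : V G → List (V G)
  neighbours u = filterᵇ (adj G u) (allFin (n G))

  ∈-neighbours : {u v : V G} → Adj G u v → v ∈ neighbours u
  ∈-neighbours {v = v} uv = ∈-filter⁺ _ (∈-allFin v) (Equivalence.from T-≡ uv)

  edgeNeighbours : Edge → List (V G)
  edgeNeighbours (u , v) = neighbours u ++ neighbours v

  nearby : Edge → List (V G)
  nearby e = edgeNeighbours e ++ concatMap neighbours (edgeNeighbours e)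

  ∈-edgeNeighbours : ∀ {e u v} → u ∈ᵉ e → Adj G u v → v ∈ edgeNeighbours e
  ∈-edgeNeighbours (inj₁ refl) uv = ∈-++⁺ˡ (∈-neighbours uv)
  ∈-edgeNeighbours {e = u , _} (inj₂ refl) uv = ∈-++⁺ʳ (neighbours u) (∈-neighbours uv)

  ∈-nearby¹ : ∀ {e u v} → u ∈ᵉ e → Adj G u v → v ∈ nearby e
  ∈-nearby¹ u∈e uv = ∈-++⁺ˡ (∈-edgeNeighbours u∈e uv)

  ∈-nearby² : ∀ {e u w v} → u ∈ᵉ e → Adj G u w → Adj G w v → v ∈ nearby e
  ∈-nearby² {e} u∈e uw wv = ∈-++⁺ʳ (edgeNeighbours e)
    (∈-concatMap⁺ neighbours (Any.map (λ { refl → ∈-neighbours wv }) (∈-edgeNeighbours u∈e uw)))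

  Meets : List (V G) → Edge → Set
  Meets s (u , v) = u ∈ s ⊎ v ∈ s

  Meets? : ∀ s → Decidable (Meets s)
  Meets? s (u , v) = (u ∈? s) ⊎-dec (v ∈? s)
    where open import Data.List.Membership.DecPropositional (_≟ᶠ_ {n G}) using (_∈?_)

  Far : Edge → Edge → Set
  Far e f = ∀ u v → u ∈ᵉ e → v ∈ᵉ f →
            ¬ Adj G u v × ¬ (∃ λ w → Adj G u w × Adj G w v)

  Far-sym : Symmetric Far
  Far-sym far u v u∈f v∈e =
    (λ uv → proj₁ (far v u v∈e u∈f) (Adj-sym uv)) ,
    (λ (w , uw , wv) → proj₂ (far v u v∈e u∈f) (w , Adj-sym wv , Adj-sym uw))

  ¬Meets-nearby⇒Far : ∀ {e f} → ¬ Meets (nearby e) f → Far e f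
  ¬Meets-nearby⇒Far {e} {f} ¬meets u v u∈e v∈f =
    (λ uv → ¬meets (meets v∈f (∈-nearby¹ u∈e uv))) ,
    (λ (w , uw , wv) → ¬meets (meets v∈f (∈-nearby² u∈e uw wv)))
    where
    meets : ∀ {s} → v ∈ᵉ f → v ∈ s → Meets s f
    meets (inj₁ refl) = inj₁
    meets (inj₂ refl) = inj₂

  endpoints-⊆ : {L M : List Edge} → L ⊆ M → endpoints G L ⊆ endpoints G M
  endpoints-⊆ []               = []
  endpoints-⊆ ((u , v) ∷ʳ sub) = u ∷ʳ v ∷ʳ endpoints-⊆ sub
  endpoints-⊆ (refl ∷ sub)     = refl ∷ refl ∷ endpoints-⊆ sub

  IsMatching-resp-⊇ : {L M : List Edge} → L ⊆ M → IsMatching G M → IsMatching G L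
  IsMatching-resp-⊇ sub (edges , unique) = All-resp-⊆ sub edges , AllPairs-resp-⊇ (endpoints-⊆ sub) unique

  meetingEndpoints : ∀ {s} L → All (Meets s) L →
                     ∃ λ ws → ws ⊆ endpoints G L × All (_∈ s) ws × length ws ≡ length L
  meetingEndpoints [] [] = [] , [] , [] , refl
  meetingEndpoints ((u , v) ∷ L) (meets ∷ L-meets) with meetingEndpoints L L-meets
  ... | ws , sub , ws⊆s , len with meets
  ...   | inj₁ u∈s = u ∷ ws , refl ∷ (v ∷ʳ sub) , u∈s ∷ ws⊆s , cong suc len
  ...   | inj₂ v∈s = v ∷ ws , u ∷ʳ (refl ∷ sub) , v∈s ∷ ws⊆s , cong suc len

  -- Distinct edges of a matching meet s in distinct vertices.
  Unique-endpoints-length-≤ : ∀ {s L} → Unique (endpoints G L) → All (Meets s) L → length L ≤ length s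
  Unique-endpoints-length-≤ {L = L} unique L-meets with meetingEndpoints L L-meets
  ... | ws , sub , ws⊆s , len = subst (_≤ _) len (Unique-length-≤ (AllPairs-resp-⊇ sub unique) ws⊆s)

  module _ {c : ℕ} (degree≤c : ∀ v → degree G v ≤ c) where

    length-nearby : ∀ e → length (nearby e) ≤ 2 * (c * c) + 2 * c
    length-nearby (u , v) = begin
      length (N ++ concatMap neighbours N)          ≡⟨ length-++ N ⟩
      length N + length (concatMap neighbours N)    ≤⟨ +-monoʳ-≤ (length N) (length-concatMap-≤ neighbours degree≤c N) ⟩
      length N + length N * c                       ≤⟨ +-mono-≤ length-N (*-monoˡ-≤ c length-N) ⟩
      (c + c) + (c + c) * c                         ≡⟨ 2c+2c·c c ⟩
      2 * (c * c) + 2 * c                           ∎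
      where
      open ≤-Reasoning
      2c+2c·c : ∀ c → (c + c) + (c + c) * c ≡ 2 * (c * c) + 2 * c
      2c+2c·c = solve-∀
      N = edgeNeighbours (u , v)
      length-N : length N ≤ c + c
      length-N = subst (_≤ c + c) (sym (length-++ (neighbours u))) (+-mono-≤ (degree≤c u) (degree≤c v))

    record DistantSubmatching (M : List Edge) : Set where
      field
        edges     : List Edge
        edges⊆M   : edges ⊆ M
        far       : AllPairs Far edges
        large     : length M ≤ (2 * (c * c) + 2 * c + 1) * length edges

    -- Fuel k, since the recursive call is on a filtered list, which is not structurally smaller.
    greedy : ∀ k M → length M ≤ k → Unique (endpoints G M) → DistantSubmatching M
    greedy _ [] _ _ = record { edges = [] ; edges⊆M = [] ; far = [] ; large = z≤n }
    greedy (suc k) (e ∷ M) (s≤s |M|≤k) (_ ∷ _ ∷ unique) = record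
      { edges   = e ∷ edges
      ; edges⊆M = refl ∷ ⊆-trans edges⊆M (filter-⊆ far? M)
      ; far     = All.map ¬Meets-nearby⇒Far (All-resp-⊆ edges⊆M (all-filter far? M)) ∷ far
      ; large   = subst (λ l → suc l ≤ (2 * (c * c) + 2 * c + 1) * suc (length edges))
                    (length-filter+length-filter-∁ near? M)
                    (suc-+-≤-*-suc (2 * (c * c) + 2 * c) (length edges) length-close large)
      }
      where
      near? = Meets? (nearby e)
      far?  = ∁? near?
      open DistantSubmatching
        (greedy k (filter far? M) (≤-trans (length-filter far? M) |M|≤k)
                (AllPairs-resp-⊇ (endpoints-⊆ (filter-⊆ far? M)) unique))
      length-close : length (filter near? M) ≤ 2 * (c * c) + 2 * c
      length-close = ≤-trans
        (Unique-endpoints-length-≤ (AllPairs-resp-⊇ (endpoints-⊆ (filter-⊆ near? M)) unique) (all-filter near? M))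
        (length-nearby e)

    distantWidth⇒matchingWidth : ∀ σ {d} → WidthAtMost G (IsDistantMatching G) σ d →
                                 WidthAtMost G (IsMatching G) σ ((2 * (c * c) + 2 * c + 1) * d)
    distantWidth⇒matchingWidth σ width k k≤n M matching@(_ , unique) crossing =
      ≤-trans large (*-monoʳ-≤ (2 * (c * c) + 2 * c + 1) (width k k≤n edges distant (All-resp-⊆ edges⊆M crossing)))
      where
      open DistantSubmatching (greedy (length M) M ≤-refl unique)
      distant : IsDistantMatching G edges
      distant = IsMatching-resp-⊇ edges⊆M matching , λ i j i≢j → AllPairs-lookup Far-sym far i≢j

proposition4 : (G : Graph) → (c : ℕ) → c ≡ maxDegree G → (m d : ℕ) → IsMW G m → IsDMW G d →
    m ≤ (2 * (c * c) + 2 * c + 1) * d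
proposition4 G c c≡Δ m d (_ , mw-minimal) ((σ , dmw-width) , _) =
  mw-minimal σ _ (distantWidth⇒matchingWidth G degree≤c σ dmw-width)
  where
  degree≤c : ∀ v → degree G v ≤ c
  degree≤c v = subst (degree G v ≤_) (sym c≡Δ) (degree≤maxDegree G v)
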